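{- For every integer $n\ge 3$, $g(n,3) \ge n/6$.
   Context: Let $S_n$ be the set of permutations of $[n]=\{1,\ldots,n\}$ (written as sequences) and $S_{n,k}$ the set of all sequences of $k$ distinct elements of $[n]$. A sequence $\kappa\in S_{n,k}$ is a subsequence of $\pi\in S_n$ if the elements of $\kappa$ appear in $\pi$ in the same relative order as in $\kappa$. A perfect sequence covering array $\mathrm{PSCA}(n,k)$ with multiplicity $\lambda$ (a positive integer) is a multiset $X$ of elements of $S_n$ such that every $\kappa\in S_{n,k}$ is a subsequence of exactly $\lambda$ elements of $X$ (counted with multiplicity). $g(n,k)$ denotes the smallest positive integer $\lambda$ such that a $\mathrm{PSCA}(n,k)$ with multiplicity $\lambda$ exists. -}

module Defs where

open import Data.Nat using (ℕ; _≤_; _*_)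
open import Data.Fin using (Fin)
open import Data.Fin.Properties using (_≟_)
open import Data.List using (List; length; filter; allFin)
open import Data.List.Relation.Unary.Unique.Propositional using (Unique)
open import Data.List.Relation.Binary.Permutation.Propositional using (_↭_)
open import Data.List.Relation.Binary.Sublist.Propositional using (_⊆_)
import Data.List.Relation.Binary.Sublist.DecPropositional as DecSub
open import Data.Product using (Σ; proj₁)
open import Relation.Binary.PropositionalEquality using (_≡_)

-- An element of S_n: a sequence (list) of elements of [n] = Fin n that is
-- a rearrangement of 0,1,...,n-1 (i.e. each element of [n] exactly once).
Perm : ℕ → Set
Perm n = Σ (List (Fin n)) (λ π → π ↭ allFin n)

IsSeq : (n k : ℕ) → List (Fin n) → Set
IsSeq n k κ = (length κ ≡ k) × Unique κ
  where open import Data.Product using (_×_)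

IsSubseq : {n : ℕ} → List (Fin n) → Perm n → Set
IsSubseq κ π = κ ⊆ proj₁ π

-- Number of elements of the multiset X (a list, counted with multiplicity)
-- containing κ as a subsequence.
count : {n : ℕ} → List (Fin n) → List (Perm n) → ℕ
count {n} κ X = length (filter (λ π → κ ⊆? proj₁ π) X)
  where open DecSub (_≟_ {n}) using (_⊆?_)

IsPSCA : (n k λ′ : ℕ) → List (Perm n) → Set
IsPSCA n k λ′ X = (κ : List (Fin n)) → IsSeq n k κ → count κ X ≡ λ′

module Submission where

-- A PSCA(n,3) X has |X| = 6λ elements.  Fix the pivot symbol 0 and,
-- for each of the m = n - 1 other symbols b, the ±1-vector sign b on X that
-- records whether b precedes 0.  Counting patterns of length 3 in X shows that
-- every sign b sums to 0, has squared norm 6λ = 4λ + 2λ, and that distinct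
-- sign vectors have inner product 2λ.  A Gram matrix A·I + C·J with A > 0 and
-- C ≥ 0 is nonsingular, so these m vectors and the constant vector are linearly
-- independent in ℤ^X and m + 1 ≤ |X|.  Over the integers this rank bound is
-- proved with the orthogonal projection onto their span, scaled by an integer
-- D > 0 to clear denominators: it is idempotent, so each diagonal entry is at
-- most D, and its trace is D·(m + 1); hence D·(m + 1) ≤ D·|X|.

open import Defs
open import Data.Nat using (ℕ; suc)
open import Data.List using (List)
open import Relation.Binary.Definitions using (DecidableEquality)
open import Relation.Binary.PropositionalEquality using (subst)

module Subsequence {A : Set} (_≟_ : DecidableEquality A) where
  open import Data.Bool using (if_then_else_)
  open import Data.Integer using (ℤ; +_; _+_; _*_)
  open import Data.Integer.Properties using (+-identityʳ; +-identityˡ; *-identityˡ; *-identityʳ)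
  open import Data.List using ([]; _∷_; [_])
  open import Data.List.Membership.Propositional using (_∈_; _∉_)
  open import Data.List.Relation.Unary.All as All using (All)
  open import Data.List.Relation.Unary.Any using (here; there)
  open import Data.List.Relation.Unary.Unique.Propositional using (Unique; _∷_)
  open import Data.List.Relation.Binary.Sublist.Propositional using (_⊆_; _∷_; _∷ʳ_; lookup; to∈; from∈)
  open import Data.List.Relation.Binary.Sublist.DecPropositional _≟_ using (_⊆?_)
  open import Data.Sum using (_⊎_; inj₁; inj₂)
  open import Relation.Binary.PropositionalEquality using (_≡_; _≢_; refl; sym; trans; cong₂; module ≡-Reasoning)
  open import Relation.Nullary using (¬_; does; yes; no; contradiction)
  open ≡-Reasoning

  χ : List A → List A → ℤ
  χ κ l = if does (κ ⊆? l) then + 1 else + 0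

  χ-yes : ∀ {κ l} → κ ⊆ l → χ κ l ≡ + 1
  χ-yes {κ} {l} κ⊆l with κ ⊆? l
  ... | yes _    = refl
  ... | no κ⊈l   = contradiction κ⊆l κ⊈l

  χ-no : ∀ {κ l} → ¬ κ ⊆ l → χ κ l ≡ + 0
  χ-no {κ} {l} κ⊈l with κ ⊆? l
  ... | yes κ⊆l  = contradiction κ⊆l κ⊈l
  ... | no _     = refl

  χ-01 : ∀ κ l → χ κ l ≡ + 0 ⊎ χ κ l ≡ + 1
  χ-01 κ l with κ ⊆? l
  ... | yes _ = inj₂ refl
  ... | no _  = inj₁ refl

  χ-cong : ∀ {κ l κ′ l′} → (κ ⊆ l → κ′ ⊆ l′) → (κ′ ⊆ l′ → κ ⊆ l) → χ κ l ≡ χ κ′ l′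
  χ-cong {κ′ = κ′} {l′} to from with κ′ ⊆? l′
  ... | yes κ′⊆l′ = χ-yes (from κ′⊆l′)
  ... | no κ′⊈l′  = χ-no (λ κ⊆l → κ′⊈l′ (to κ⊆l))

  χ-skip : ∀ {h x : A} {κ t} → h ≢ x → χ (x ∷ κ) (h ∷ t) ≡ χ (x ∷ κ) t
  χ-skip {h} {x} {κ} {t} h≢x = χ-cong skip (h ∷ʳ_)
    where
    skip : (x ∷ κ) ⊆ (h ∷ t) → (x ∷ κ) ⊆ t
    skip (_ ∷ʳ p)   = p
    skip (h≡x ∷ _)  = contradiction (sym h≡x) h≢x

  χ-match : ∀ {x : A} {κ t} → x ∉ t → χ (x ∷ κ) (x ∷ t) ≡ χ κ t
  χ-match {x} {κ} {t} x∉t = χ-cong match (refl ∷_)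
    where
    match : (x ∷ κ) ⊆ (x ∷ t) → κ ⊆ t
    match (_ ∷ʳ p)  = contradiction (to∈ p) x∉t
    match (_ ∷ p)   = p

  χ-absent : ∀ {x : A} {κ l} → x ∈ κ → x ∉ l → χ κ l ≡ + 0
  χ-absent x∈κ x∉l = χ-no (λ κ⊆l → x∉l (lookup κ⊆l x∈κ))

  χ-singleton : ∀ {y : A} {l} → y ∈ l → χ [ y ] l ≡ + 1
  χ-singleton y∈l = χ-yes (from∈ y∈l)

  χ-late : ∀ {h x : A} {κ t} → h ≢ x → h ∈ κ → h ∉ t → χ (x ∷ κ) (h ∷ t) ≡ + 0
  χ-late h≢x h∈κ h∉t = trans (χ-skip h≢x) (χ-absent (there h∈κ) h∉t)

  private
    fresh : ∀ {h : A} {t} → All (h ≢_) t → h ∉ t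
    fresh h≢t h∈t = All.lookup h≢t h∈t refl

    ∈-tail : ∀ {h y : A} {t} → y ∈ h ∷ t → h ≢ y → y ∈ t
    ∈-tail (here refl) h≢y = contradiction refl h≢y
    ∈-tail (there y∈t) _   = y∈t

  order-dichotomy : ∀ {l} {x y : A} → Unique l → x ∈ l → y ∈ l → x ≢ y →
                    χ (x ∷ y ∷ []) l + χ (y ∷ x ∷ []) l ≡ + 1
  order-dichotomy {h ∷ t} {x} {y} (h≢t ∷ u) x∈l y∈l x≢y with h ≟ x | h ≟ y
  ... | yes refl | _ =
    cong₂ _+_ (trans (χ-match (fresh h≢t)) (χ-singleton (∈-tail y∈l x≢y)))
              (χ-late x≢y (here refl) (fresh h≢t))
  ... | no h≢x | yes refl =
    cong₂ _+_ (χ-late h≢x (here refl) (fresh h≢t))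
              (trans (χ-match (fresh h≢t)) (χ-singleton (∈-tail x∈l h≢x)))
  ... | no h≢x | no h≢y =
    trans (cong₂ _+_ (χ-skip h≢x) (χ-skip h≢y))
          (order-dichotomy u (∈-tail x∈l h≢x) (∈-tail y∈l h≢y) x≢y)

  -- Inserting a third element z into the pattern x,y: an occurrence of x
  -- before y has z before, between or after them.
  insert-third : ∀ {l} {x y z : A} → Unique l → x ∈ l → y ∈ l → z ∈ l →
                 x ≢ y → x ≢ z → y ≢ z →
                 χ (x ∷ y ∷ []) l ≡
                 χ (x ∷ y ∷ z ∷ []) l + χ (x ∷ z ∷ y ∷ []) l + χ (z ∷ x ∷ y ∷ []) l
  insert-third {h ∷ t} {x} {y} {z} (h≢t ∷ u) x∈l y∈l z∈l x≢y x≢z y≢z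
    with h ≟ x | h ≟ y | h ≟ z
  ... | yes refl | _ | _ = begin
    χ (x ∷ y ∷ []) (x ∷ t)                         ≡⟨ χ-match h∉t ⟩
    χ [ y ] t                                      ≡⟨ χ-singleton y∈t ⟩
    + 1                                            ≡⟨ order-dichotomy u y∈t z∈t y≢z ⟨
    χ (y ∷ z ∷ []) t + χ (z ∷ y ∷ []) t            ≡⟨ +-identityʳ _ ⟨
    χ (y ∷ z ∷ []) t + χ (z ∷ y ∷ []) t + + 0
      ≡⟨ cong₂ _+_ (cong₂ _+_ (χ-match h∉t) (χ-match h∉t))
                   (χ-late x≢z (here refl) h∉t) ⟨
    χ (x ∷ y ∷ z ∷ []) (x ∷ t) + χ (x ∷ z ∷ y ∷ []) (x ∷ t) + χ (z ∷ x ∷ y ∷ []) (x ∷ t) ∎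
    where
    h∉t = fresh h≢t
    y∈t = ∈-tail y∈l x≢y
    z∈t = ∈-tail z∈l x≢z
  ... | no h≢x | yes refl | _ =
    trans (χ-late h≢x (here refl) h∉t)
          (sym (cong₂ _+_ (cong₂ _+_ (χ-late h≢x (here refl) h∉t)
                                     (χ-late h≢x (there (here refl)) h∉t))
                          (χ-late y≢z (there (here refl)) h∉t)))
    where h∉t = fresh h≢t
  ... | no h≢x | no h≢y | yes refl =
    trans (χ-skip h≢x)
          (sym (trans (cong₂ _+_ (cong₂ _+_ (χ-late h≢x (there (here refl)) h∉t)
                                            (χ-late h≢x (here refl) h∉t))
                                 (χ-match h∉t))
                      (+-identityˡ _)))
    where h∉t = fresh h≢t
  ... | no h≢x | no h≢y | no h≢z =
    trans (χ-skip h≢x)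
      (trans (insert-third u (∈-tail x∈l h≢x) (∈-tail y∈l h≢y) (∈-tail z∈l h≢z) x≢y x≢z y≢z)
             (sym (cong₂ _+_ (cong₂ _+_ (χ-skip h≢x) (χ-skip h≢x)) (χ-skip h≢z))))

  both-before : ∀ {l} {x y z : A} → Unique l → x ∈ l → y ∈ l → z ∈ l →
                x ≢ y → x ≢ z → y ≢ z →
                χ (x ∷ z ∷ []) l * χ (y ∷ z ∷ []) l ≡
                χ (x ∷ y ∷ z ∷ []) l + χ (y ∷ x ∷ z ∷ []) l
  both-before {h ∷ t} {x} {y} {z} (h≢t ∷ u) x∈l y∈l z∈l x≢y x≢z y≢z
    with h ≟ x | h ≟ y | h ≟ z
  ... | yes refl | _ | _ =
    trans (cong₂ _*_ (trans (χ-match h∉t) (χ-singleton (∈-tail z∈l x≢z))) (χ-skip x≢y))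
          (trans (*-identityˡ _)
                 (sym (trans (cong₂ _+_ (χ-match h∉t) (χ-late x≢y (here refl) h∉t))
                             (+-identityʳ _))))
    where h∉t = fresh h≢t
  ... | no h≢x | yes refl | _ =
    trans (cong₂ _*_ (χ-skip h≢x) (trans (χ-match h∉t) (χ-singleton (∈-tail z∈l y≢z))))
          (trans (*-identityʳ (χ (x ∷ z ∷ []) t))
                 (sym (trans (cong₂ _+_ (χ-late h≢x (here refl) h∉t) (χ-match h∉t))
                             (+-identityˡ (χ (x ∷ z ∷ []) t)))))
    where h∉t = fresh h≢t
  ... | no h≢x | no h≢y | yes refl =
    trans (cong₂ _*_ (χ-late h≢x (here refl) h∉t) refl)
          (sym (cong₂ _+_ (χ-late h≢x (there (here refl)) h∉t)
                          (χ-late h≢y (there (here refl)) h∉t)))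
    where h∉t = fresh h≢t
  ... | no h≢x | no h≢y | no h≢z =
    trans (cong₂ _*_ (χ-skip h≢x) (χ-skip h≢y))
      (trans (both-before u (∈-tail x∈l h≢x) (∈-tail y∈l h≢y) (∈-tail z∈l h≢z) x≢y x≢z y≢z)
             (sym (cong₂ _+_ (χ-skip h≢x) (χ-skip h≢y))))

module IntegerSums where
  open import Data.Nat using (zero; NonZero; z≤n)
  open import Data.Fin using (Fin; zero; suc)
  open import Data.Integer using (ℤ; +_; _+_; _*_; _≤_; +≤+; -≤+; +[1+_]; -[1+_]; Positive; NonNegative)
  open import Data.Integer.Properties using (+-*-semiring; +-identityˡ; +-identityʳ; *-identityʳ; *-zeroʳ; *-zeroˡ; +-mono-≤; ≤-refl; ≤-trans; *-cancelʳ-≤-pos; pos-*; module ≤-Reasoning)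
  open import Data.Integer.Tactic.RingSolver using (solve-∀)
  open import Algebra.Properties.Semiring.Sum +-*-semiring public using (sum-syntax; sum-cong-≗; ∑-distrib-+; ∑-comm; *-distribˡ-sum; *-distribʳ-sum)
  open import Algebra.Properties.Semiring.Sum +-*-semiring using (sum-replicate-zero)
  open import Relation.Binary.PropositionalEquality using (_≡_; _≢_; refl; sym; trans; cong; cong₂; module ≡-Reasoning)
  open import Relation.Nullary using (contradiction)

  ∑-const : ∀ N (c : ℤ) → ∑[ j < N ] c ≡ + N * c
  ∑-const zero    c = sym (*-zeroˡ c)
  ∑-const (suc N) c = trans (cong (λ r → c + r) (∑-const N c)) (one-more c (+ N))
    where one-more : ∀ c k → c + k * c ≡ (+ 1 + k) * c
          one-more = solve-∀

  ∑-zero : ∀ {N} (f : Fin N → ℤ) → (∀ j → f j ≡ + 0) → ∑[ j < N ] f j ≡ + 0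
  ∑-zero {N} f f≡0 = trans (sum-cong-≗ f≡0) (sum-replicate-zero N)

  ∑-linear₂ : ∀ {N} x y (f g : Fin N → ℤ) →
              ∑[ j < N ] (x * f j + y * g j) ≡ x * ∑[ j < N ] f j + y * ∑[ j < N ] g j
  ∑-linear₂ x y f g = trans (∑-distrib-+ (λ j → x * f j) (λ j → y * g j))
                            (sym (cong₂ _+_ (*-distribˡ-sum x f) (*-distribˡ-sum y g)))

  ∑-linear₃ : ∀ {N} x y z (f g h : Fin N → ℤ) →
              ∑[ j < N ] (x * f j + y * g j + z * h j) ≡
              x * ∑[ j < N ] f j + y * ∑[ j < N ] g j + z * ∑[ j < N ] h j
  ∑-linear₃ x y z f g h = trans (∑-distrib-+ (λ j → x * f j + y * g j) (λ j → z * h j))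
                                (cong₂ _+_ (∑-linear₂ x y f g) (sym (*-distribˡ-sum z h)))

  δ : ∀ {m} → Fin m → Fin m → ℤ
  δ zero    zero    = + 1
  δ zero    (suc _) = + 0
  δ (suc _) zero    = + 0
  δ (suc b) (suc c) = δ b c

  δ-diag : ∀ {m} (b : Fin m) → δ b b ≡ + 1
  δ-diag zero    = refl
  δ-diag (suc b) = δ-diag b

  δ-off : ∀ {m} {b c : Fin m} → b ≢ c → δ b c ≡ + 0
  δ-off {b = zero}  {zero}  b≢c = contradiction refl b≢c
  δ-off {b = zero}  {suc c} _   = refl
  δ-off {b = suc b} {zero}  _   = refl
  δ-off {b = suc b} {suc c} b≢c = δ-off (λ b≡c → b≢c (cong suc b≡c))

  ∑-δ : ∀ {m} (f : Fin m → ℤ) (c : Fin m) → ∑[ b < m ] (f b * δ c b) ≡ f c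
  ∑-δ {suc m} f zero = begin
    f zero * + 1 + ∑[ b < m ] (f (suc b) * + 0)
      ≡⟨ cong₂ _+_ (*-identityʳ (f zero)) (∑-zero _ (λ b → *-zeroʳ (f (suc b)))) ⟩
    f zero + + 0
      ≡⟨ +-identityʳ (f zero) ⟩
    f zero ∎
    where open ≡-Reasoning
  ∑-δ {suc m} f (suc c) = begin
    f zero * + 0 + ∑[ b < m ] (f (suc b) * δ c b)
      ≡⟨ cong (λ r → r + ∑[ b < m ] (f (suc b) * δ c b)) (*-zeroʳ (f zero)) ⟩
    + 0 + ∑[ b < m ] (f (suc b) * δ c b)
      ≡⟨ +-identityˡ _ ⟩
    ∑[ b < m ] (f (suc b) * δ c b)
      ≡⟨ ∑-δ (λ b → f (suc b)) c ⟩
    f (suc c) ∎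
    where open ≡-Reasoning

  ∑-mono : ∀ {N} (f g : Fin N → ℤ) → (∀ j → f j ≤ g j) → ∑[ j < N ] f j ≤ ∑[ j < N ] g j
  ∑-mono {zero}  f g f≤g = ≤-refl
  ∑-mono {suc N} f g f≤g = +-mono-≤ (f≤g zero) (∑-mono (λ j → f (suc j)) (λ j → g (suc j)) (λ j → f≤g (suc j)))

  ∑-nonneg : ∀ {N} (f : Fin N → ℤ) → (∀ j → + 0 ≤ f j) → + 0 ≤ ∑[ j < N ] f j
  ∑-nonneg {zero}  f 0≤f = ≤-refl
  ∑-nonneg {suc N} f 0≤f = +-mono-≤ (0≤f zero) (∑-nonneg (λ j → f (suc j)) (λ j → 0≤f (suc j)))

  square-nonneg : ∀ i → + 0 ≤ i * i
  square-nonneg (+ 0)     = +≤+ z≤n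
  square-nonneg +[1+ n ]  = +≤+ z≤n
  square-nonneg -[1+ n ]  = +≤+ z≤n

  square≤∑squares : ∀ {N} (f : Fin N → ℤ) (i : Fin N) → f i * f i ≤ ∑[ j < N ] (f j * f j)
  square≤∑squares {suc N} f zero = begin
    f zero * f zero                                       ≡⟨ +-identityʳ _ ⟨
    f zero * f zero + + 0                                 ≤⟨ +-mono-≤ (≤-refl {f zero * f zero}) rest-nonneg ⟩
    f zero * f zero + ∑[ j < N ] (f (suc j) * f (suc j))  ∎
    where
    open ≤-Reasoning
    rest-nonneg : + 0 ≤ ∑[ j < N ] (f (suc j) * f (suc j))
    rest-nonneg = ∑-nonneg (λ j → f (suc j) * f (suc j)) (λ j → square-nonneg (f (suc j)))
  square≤∑squares {suc N} f (suc i) = begin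
    f (suc i) * f (suc i)                                 ≤⟨ square≤∑squares (λ j → f (suc j)) i ⟩
    ∑[ j < N ] (f (suc j) * f (suc j))                    ≡⟨ +-identityˡ _ ⟨
    + 0 + ∑[ j < N ] (f (suc j) * f (suc j))              ≤⟨ +-mono-≤ (square-nonneg (f zero)) ≤-refl ⟩
    f zero * f zero + ∑[ j < N ] (f (suc j) * f (suc j))  ∎
    where open ≤-Reasoning

  positive-ℕ : ∀ n .{{_ : NonZero n}} → Positive (+ n)
  positive-ℕ (suc n) = _

  *-positive : ∀ i j .{{_ : Positive i}} .{{_ : Positive j}} → Positive (i * j)
  *-positive +[1+ m ] +[1+ n ] = _

  *-nonNegative : ∀ i j .{{_ : NonNegative i}} .{{_ : NonNegative j}} → NonNegative (i * j)
  *-nonNegative (+ m) (+ n) = subst NonNegative (pos-* m n) _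

  +-positive : ∀ i j .{{_ : Positive i}} .{{_ : NonNegative j}} → Positive (i + j)
  +-positive +[1+ m ] (+ n) = _

  square-bound : ∀ {d} t → + 0 ≤ d → t * t ≤ d * t → t ≤ d
  square-bound (+ 0)     0≤d _   = 0≤d
  square-bound +[1+ n ]  0≤d t≤d = *-cancelʳ-≤-pos +[1+ n ] _ +[1+ n ] t≤d
  square-bound -[1+ n ]  0≤d _   = ≤-trans -≤+ 0≤d

module GramRank where
  open import Data.Nat using (NonZero)
  import Data.Nat as ℕ
  open import Data.Fin using (Fin)
  open import Data.Fin.Properties using (_≟_)
  open import Data.Integer using (ℤ; +_; -_; _+_; _-_; _*_; _≤_; Positive; NonNegative)
  open import Data.Integer.Properties using (*-identityˡ; *-identityʳ; +-identityˡ; *-zeroʳ; ≤-trans; ≤-reflexive; *-cancelˡ-≤-pos; drop‿+≤+; *-comm; <⇒≤; positive⁻¹)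
  open import Data.Integer.Tactic.RingSolver using (solve-∀)
  open import Relation.Binary.PropositionalEquality using (_≡_; _≢_; refl; sym; trans; cong; cong₂; module ≡-Reasoning)
  open import Relation.Nullary using (yes; no)
  open IntegerSums

  module _
    (N m : ℕ) .{{_ : NonZero N}} (A C : ℤ) .{{_ : Positive A}} .{{_ : NonNegative C}}
    (v : Fin m → Fin N → ℤ)
    (centred     : ∀ b → ∑[ j < N ] v b j ≡ + 0)
    (norm        : ∀ b → ∑[ j < N ] (v b j * v b j) ≡ A + C)
    (correlation : ∀ b b′ → b ≢ b′ → ∑[ j < N ] (v b j * v b′ j) ≡ C)
    where

    open ≡-Reasoning

    gram : ∀ b b′ → ∑[ j < N ] (v b j * v b′ j) ≡ A * δ b b′ + C
    gram b b′ with b ≟ b′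
    ... | yes refl = trans (norm b) (cong (_+ C) (sym (trans (cong (A *_) (δ-diag b)) (*-identityʳ A))))
    ... | no b≢b′  = trans (correlation b b′ b≢b′)
                           (sym (trans (cong (λ d → A * d + C) (δ-off b≢b′)) (trans (cong (_+ C) (*-zeroʳ A)) (+-identityˡ C))))

    K : Fin N → Fin N → ℤ
    K i j = ∑[ b < m ] (v b i * v b j)

    s : Fin N → ℤ
    s j = ∑[ b < m ] v b j

    expand : ∀ (w : Fin m → ℤ) (g : Fin N → ℤ) →
             ∑[ j < N ] (∑[ b < m ] (w b * v b j) * g j) ≡ ∑[ b < m ] (w b * ∑[ j < N ] (g j * v b j))
    expand w g = begin
      ∑[ j < N ] (∑[ b < m ] (w b * v b j) * g j)   ≡⟨ sum-cong-≗ (λ j → *-distribʳ-sum (g j) (λ b → w b * v b j)) ⟩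
      ∑[ j < N ] ∑[ b < m ] (w b * v b j * g j)     ≡⟨ ∑-comm (λ j b → w b * v b j * g j) ⟩
      ∑[ b < m ] ∑[ j < N ] (w b * v b j * g j)     ≡⟨ sum-cong-≗ (λ b → sum-cong-≗ (λ j → reorder (w b) (v b j) (g j))) ⟩
      ∑[ b < m ] ∑[ j < N ] (w b * (g j * v b j))   ≡⟨ sum-cong-≗ (λ b → *-distribˡ-sum (w b) (λ j → g j * v b j)) ⟨
      ∑[ b < m ] (w b * ∑[ j < N ] (g j * v b j))   ∎
      where reorder : ∀ x y z → x * y * z ≡ x * (z * y)
            reorder = solve-∀

    kernel-expand : ∀ i (g : Fin N → ℤ) →
                    ∑[ j < N ] (K i j * g j) ≡ ∑[ b < m ] (v b i * ∑[ j < N ] (g j * v b j))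
    kernel-expand i = expand (λ b → v b i)

    sum-expand : ∀ (g : Fin N → ℤ) → ∑[ j < N ] (s j * g j) ≡ ∑[ b < m ] ∑[ j < N ] (g j * v b j)
    sum-expand g = begin
      ∑[ j < N ] (s j * g j)                              ≡⟨ sum-cong-≗ (λ j → cong (_* g j) (sum-cong-≗ (λ b → *-identityˡ (v b j)))) ⟨
      ∑[ j < N ] (∑[ b < m ] (+ 1 * v b j) * g j)         ≡⟨ expand (λ _ → + 1) g ⟩
      ∑[ b < m ] (+ 1 * ∑[ j < N ] (g j * v b j))         ≡⟨ sum-cong-≗ (λ b → *-identityˡ (∑[ j < N ] (g j * v b j))) ⟩
      ∑[ b < m ] ∑[ j < N ] (g j * v b j)                 ∎

    kernel-on-v : ∀ i c → ∑[ j < N ] (K i j * v c j) ≡ A * v c i + C * s i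
    kernel-on-v i c = begin
      ∑[ j < N ] (K i j * v c j)                          ≡⟨ kernel-expand i (v c) ⟩
      ∑[ b < m ] (v b i * ∑[ j < N ] (v c j * v b j))     ≡⟨ sum-cong-≗ (λ b → cong (v b i *_) (gram c b)) ⟩
      ∑[ b < m ] (v b i * (A * δ c b + C))                ≡⟨ sum-cong-≗ (λ b → distribute (v b i) (δ c b) A C) ⟩
      ∑[ b < m ] (A * (v b i * δ c b) + C * v b i)        ≡⟨ ∑-linear₂ A C (λ b → v b i * δ c b) (λ b → v b i) ⟩
      A * ∑[ b < m ] (v b i * δ c b) + C * s i            ≡⟨ cong (λ r → A * r + C * s i) (∑-δ (λ b → v b i) c) ⟩
      A * v c i + C * s i                                 ∎
      where distribute : ∀ x d A C → x * (A * d + C) ≡ A * (x * d) + C * x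
            distribute = solve-∀

    B : ℤ
    B = A + + m * C

    sum-on-v : ∀ c → ∑[ j < N ] (s j * v c j) ≡ B
    sum-on-v c = begin
      ∑[ j < N ] (s j * v c j)                            ≡⟨ sum-expand (v c) ⟩
      ∑[ b < m ] ∑[ j < N ] (v c j * v b j)               ≡⟨ sum-cong-≗ (gram c) ⟩
      ∑[ b < m ] (A * δ c b + C)                          ≡⟨ ∑-distrib-+ (λ b → A * δ c b) (λ _ → C) ⟩
      ∑[ b < m ] (A * δ c b) + ∑[ b < m ] C               ≡⟨ cong₂ _+_ (∑-δ (λ _ → A) c) (∑-const m C) ⟩
      B                                                   ∎

    kernel-on-1 : ∀ i → ∑[ j < N ] (K i j * + 1) ≡ + 0
    kernel-on-1 i = trans (kernel-expand i (λ _ → + 1))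
      (∑-zero _ (λ b → trans (cong (v b i *_) (trans (sum-cong-≗ (λ j → *-identityˡ (v b j))) (centred b))) (*-zeroʳ (v b i))))

    sum-on-1 : ∑[ j < N ] (s j * + 1) ≡ + 0
    sum-on-1 = trans (sum-expand (λ _ → + 1))
      (∑-zero _ (λ b → trans (sum-cong-≗ (λ j → *-identityˡ (v b j))) (centred b)))

    -- T / D is the orthogonal projection onto the span of 1 and the v b;
    -- T is scaled by D so that all its entries are integers.
    D : ℤ
    D = + N * A * B

    T : Fin N → Fin N → ℤ
    T i j = A * B + + N * B * K i j - + N * C * s i * s j

    T-apply : ∀ i (g : Fin N → ℤ) {p q r} →
              ∑[ j < N ] g j ≡ p → ∑[ j < N ] (K i j * g j) ≡ q → ∑[ j < N ] (s j * g j) ≡ r →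
              ∑[ j < N ] (T i j * g j) ≡ A * B * p + + N * B * q + - (+ N * C * s i) * r
    T-apply i g refl refl refl =
      trans (sum-cong-≗ (λ j → split A B (+ N) C (K i j) (s i) (s j) (g j)))
            (∑-linear₃ (A * B) (+ N * B) (- (+ N * C * s i)) g (λ j → K i j * g j) (λ j → s j * g j))
      where split : ∀ A B N C k si sj x → (A * B + N * B * k - N * C * si * sj) * x ≡
                                          A * B * x + N * B * (k * x) + - (N * C * si) * (sj * x)
            split = solve-∀

    reproduce-v : ∀ i c → ∑[ j < N ] (T i j * v c j) ≡ D * v c i
    reproduce-v i c = trans (T-apply i (v c) (centred c) (kernel-on-v i c) (sum-on-v c))
                            (collect A C (+ N) (+ m) (v c i) (s i))
      where collect : ∀ A C N m x y → A * (A + m * C) * + 0 + N * (A + m * C) * (A * x + C * y)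
                                        + - (N * C * y) * (A + m * C) ≡ N * A * (A + m * C) * x
            collect = solve-∀

    reproduce-1 : ∀ i → ∑[ j < N ] (T i j * + 1) ≡ D
    reproduce-1 i = trans (T-apply i (λ _ → + 1) (∑-const N (+ 1)) (kernel-on-1 i) sum-on-1)
                          (collect A B (+ N) (+ N * C * s i))
      where collect : ∀ A B N z → A * B * (N * + 1) + N * B * + 0 + - z * + 0 ≡ N * A * B
            collect = solve-∀

    -- T i · lies in the span it reproduces, hence (T / D)² = T / D.
    idempotent : ∀ i → ∑[ j < N ] (T i j * T i j) ≡ D * T i i
    idempotent i = trans (T-apply i (T i) T-on-1 K-on-T s-on-T)
                         (factor-D A B C (+ N) (K i i) (s i) (s i))
      where
      T-on-1 : ∑[ j < N ] T i j ≡ D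
      T-on-1 = trans (sum-cong-≗ (λ j → sym (*-identityʳ (T i j)))) (reproduce-1 i)

      K-on-T : ∑[ j < N ] (K i j * T i j) ≡ D * K i i
      K-on-T = begin
        ∑[ j < N ] (K i j * T i j)                      ≡⟨ kernel-expand i (T i) ⟩
        ∑[ b < m ] (v b i * ∑[ j < N ] (T i j * v b j)) ≡⟨ sum-cong-≗ (λ b → cong (v b i *_) (reproduce-v i b)) ⟩
        ∑[ b < m ] (v b i * (D * v b i))                ≡⟨ sum-cong-≗ (λ b → reorder (v b i) D) ⟩
        ∑[ b < m ] (D * (v b i * v b i))                ≡⟨ *-distribˡ-sum D (λ b → v b i * v b i) ⟨
        D * K i i                                       ∎
        where reorder : ∀ x d → x * (d * x) ≡ d * (x * x)
              reorder = solve-∀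

      s-on-T : ∑[ j < N ] (s j * T i j) ≡ D * s i
      s-on-T = begin
        ∑[ j < N ] (s j * T i j)                        ≡⟨ sum-expand (T i) ⟩
        ∑[ b < m ] ∑[ j < N ] (T i j * v b j)           ≡⟨ sum-cong-≗ (reproduce-v i) ⟩
        ∑[ b < m ] (D * v b i)                          ≡⟨ *-distribˡ-sum D (λ b → v b i) ⟨
        D * s i                                         ∎

      factor-D : ∀ A B C N k x y → A * B * (N * A * B) + N * B * (N * A * B * k) + - (N * C * x) * (N * A * B * y)
                                   ≡ N * A * B * (A * B + N * B * k - N * C * x * y)
      factor-D = solve-∀

    trace : ∑[ i < N ] T i i ≡ D * (+ 1 + + m)
    trace = begin
      ∑[ i < N ] T i i                                            ≡⟨ sum-cong-≗ (λ i → split A B C (+ N) (K i i) (s i)) ⟩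
      ∑[ i < N ] (A * B * + 1 + + N * B * K i i + - (+ N * C) * (s i * s i))
        ≡⟨ ∑-linear₃ (A * B) (+ N * B) (- (+ N * C)) (λ _ → + 1) (λ i → K i i) (λ i → s i * s i) ⟩
      A * B * ∑[ i < N ] (+ 1) + + N * B * ∑[ i < N ] K i i + - (+ N * C) * ∑[ i < N ] (s i * s i)
        ≡⟨ cong₂ _+_ (cong₂ (λ p q → A * B * p + + N * B * q) (∑-const N (+ 1)) diagonal-sum)
                     (cong (- (+ N * C) *_) square-sum) ⟩
      A * B * (+ N * + 1) + + N * B * (+ m * (A + C)) + - (+ N * C) * (+ m * B)
        ≡⟨ factor-D A C (+ N) (+ m) ⟩
      D * (+ 1 + + m)                                             ∎
      where
      split : ∀ A B C N k x → A * B + N * B * k - N * C * x * x ≡ A * B * + 1 + N * B * k + - (N * C) * (x * x)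
      split = solve-∀

      diagonal-sum : ∑[ i < N ] K i i ≡ + m * (A + C)
      diagonal-sum = begin
        ∑[ i < N ] K i i                         ≡⟨ ∑-comm (λ i b → v b i * v b i) ⟩
        ∑[ b < m ] ∑[ i < N ] (v b i * v b i)    ≡⟨ sum-cong-≗ norm ⟩
        ∑[ b < m ] (A + C)                       ≡⟨ ∑-const m (A + C) ⟩
        + m * (A + C)                            ∎

      square-sum : ∑[ i < N ] (s i * s i) ≡ + m * B
      square-sum = trans (sum-expand s) (trans (sum-cong-≗ sum-on-v) (∑-const m B))

      factor-D : ∀ A C N m → A * (A + m * C) * (N * + 1) + N * (A + m * C) * (m * (A + C)) + - (N * C) * (m * (A + m * C))
                             ≡ N * A * (A + m * C) * (+ 1 + m)
      factor-D = solve-∀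

    instance
      D-positive : Positive D
      D-positive = *-positive (+ N * A) B
        where instance
          N-positive : Positive (+ N)
          N-positive = positive-ℕ N
          NA-positive : Positive (+ N * A)
          NA-positive = *-positive (+ N) A
          mC-nonNegative : NonNegative (+ m * C)
          mC-nonNegative = *-nonNegative (+ m) C
          B-positive : Positive B
          B-positive = +-positive A (+ m * C)

    diagonal-bound : ∀ i → T i i ≤ D
    diagonal-bound i = square-bound (T i i) (<⇒≤ (positive⁻¹ D))
      (≤-trans (square≤∑squares (T i) i) (≤-reflexive (idempotent i)))

    rank-bound : suc m ℕ.≤ N
    rank-bound = drop‿+≤+ (*-cancelˡ-≤-pos (+ suc m) (+ N) D trace≤ND)
      where
      trace≤ND : D * (+ 1 + + m) ≤ D * + N
      trace≤ND = ≤-trans (≤-reflexive (sym trace))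
                 (≤-trans (∑-mono (λ i → T i i) (λ _ → D) diagonal-bound)
                          (≤-reflexive (trans (∑-const N D) (*-comm (+ N) D))))

module PSCASigns where
  import Data.Nat as ℕ
  open import Data.Nat using (NonZero)
  open import Data.Nat.Properties using (m*n≢0)
  open import Data.Fin using (Fin; zero; suc)
  open import Data.Fin.Patterns using (0F; 1F; 2F)
  open import Data.Fin.Properties using (_≟_; suc-injective)
  open import Data.Integer using (ℤ; +_; -_; _+_; _-_; _*_; Positive; NonNegative)
  open import Data.Integer.Properties using (+-identityˡ; *-identityʳ; +-injective; pos-*)
  open import Data.Integer.Tactic.RingSolver using (solve-∀)
  open import Data.List using ([]; _∷_; length; lookup)
  open import Data.List.Membership.Propositional using (_∈_)
  open import Data.List.Membership.Propositional.Properties using (∈-allFin)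
  open import Data.List.Relation.Unary.All using ([]; _∷_)
  open import Data.List.Relation.Unary.AllPairs using ([]; _∷_)
  open import Data.List.Relation.Unary.Unique.Propositional using (Unique)
  open import Data.List.Relation.Unary.Unique.Propositional.Properties using (allFin⁺)
  open import Data.List.Relation.Binary.Permutation.Propositional using (↭-sym; ↭⇒↭ₛ)
  open import Data.List.Relation.Binary.Permutation.Propositional.Properties using (∈-resp-↭)
  import Data.List.Relation.Binary.Permutation.Setoid.Properties as PermutationProperties
  import Data.List.Relation.Binary.Sublist.DecPropositional as DecSublist
  open import Data.Product using (proj₁; _,_)
  open import Data.Sum using (inj₁; inj₂)
  open import Relation.Binary.PropositionalEquality using (_≡_; _≢_; refl; sym; trans; cong; cong₂; setoid; ≢-sym; module ≡-Reasoning)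
  open import Relation.Nullary using (yes; no)
  open IntegerSums

  module _ {n : ℕ} where
    open Subsequence (_≟_ {n})
    open DecSublist (_≟_ {n}) using (_⊆?_)

    count-as-sum : ∀ κ (Y : List (Perm n)) → + count κ Y ≡ ∑[ i < length Y ] χ κ (proj₁ (lookup Y i))
    count-as-sum κ []      = refl
    count-as-sum κ (π ∷ Y) with κ ⊆? proj₁ π
    ... | yes _ = cong (λ r → + 1 + r) (count-as-sum κ Y)
    ... | no _  = trans (count-as-sum κ Y) (sym (+-identityˡ _))

    perm-unique : (π : Perm n) → Unique (proj₁ π)
    perm-unique (π , π↭) = PermutationProperties.Unique-resp-↭ (setoid (Fin n)) (↭⇒↭ₛ (↭-sym π↭)) (allFin⁺ n)

    perm-∋ : (π : Perm n) (x : Fin n) → x ∈ proj₁ π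
    perm-∋ (π , π↭) x = ∈-resp-↭ (↭-sym π↭) (∈-allFin x)

  module PivotSigns (k λ′ : ℕ) .{{_ : NonZero λ′}} (X : List (Perm (3 ℕ.+ k)))
                    (psca : IsPSCA (3 ℕ.+ k) 3 λ′ X) where
    open Subsequence (_≟_ {3 ℕ.+ k})

    N : ℕ
    N = length X

    word : Fin N → List (Fin (3 ℕ.+ k))
    word i = proj₁ (lookup X i)

    word-unique : ∀ i → Unique (word i)
    word-unique i = perm-unique (lookup X i)

    word-∋ : ∀ i x → x ∈ word i
    word-∋ i = perm-∋ (lookup X i)

    freq : List (Fin (3 ℕ.+ k)) → ℤ
    freq κ = ∑[ i < N ] χ κ (word i)

    L : ℤ
    L = + λ′

    freq-+ : ∀ κ κ′ → ∑[ i < N ] (χ κ (word i) + χ κ′ (word i)) ≡ freq κ + freq κ′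
    freq-+ κ κ′ = ∑-distrib-+ (λ i → χ κ (word i)) (λ i → χ κ′ (word i))

    triple-freq : ∀ {x y z} → x ≢ y → x ≢ z → y ≢ z → freq (x ∷ y ∷ z ∷ []) ≡ L
    triple-freq {x} {y} {z} x≢y x≢z y≢z =
      trans (sym (count-as-sum (x ∷ y ∷ z ∷ []) X))
            (cong +_ (psca _ (refl , (x≢y ∷ x≢z ∷ []) ∷ (y≢z ∷ []) ∷ [] ∷ [])))

    pair-freq : ∀ {x y} z → x ≢ y → x ≢ z → y ≢ z → freq (x ∷ y ∷ []) ≡ + 3 * L
    pair-freq {x} {y} z x≢y x≢z y≢z = begin
      freq (x ∷ y ∷ [])
        ≡⟨ sum-cong-≗ (λ i → insert-third (word-unique i) (word-∋ i x) (word-∋ i y) (word-∋ i z) x≢y x≢z y≢z) ⟩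
      ∑[ i < N ] (χ (x ∷ y ∷ z ∷ []) (word i) + χ (x ∷ z ∷ y ∷ []) (word i) + χ (z ∷ x ∷ y ∷ []) (word i))
        ≡⟨ ∑-distrib-+ (λ i → χ (x ∷ y ∷ z ∷ []) (word i) + χ (x ∷ z ∷ y ∷ []) (word i)) (λ i → χ (z ∷ x ∷ y ∷ []) (word i)) ⟩
      ∑[ i < N ] (χ (x ∷ y ∷ z ∷ []) (word i) + χ (x ∷ z ∷ y ∷ []) (word i)) + freq (z ∷ x ∷ y ∷ [])
        ≡⟨ cong (_+ freq (z ∷ x ∷ y ∷ [])) (freq-+ (x ∷ y ∷ z ∷ []) (x ∷ z ∷ y ∷ [])) ⟩
      freq (x ∷ y ∷ z ∷ []) + freq (x ∷ z ∷ y ∷ []) + freq (z ∷ x ∷ y ∷ [])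
        ≡⟨ cong₂ _+_ (cong₂ _+_ (triple-freq x≢y x≢z y≢z) (triple-freq x≢z x≢y (≢-sym y≢z)))
                     (triple-freq (≢-sym x≢z) (≢-sym y≢z) x≢y) ⟩
      L + L + L
        ≡⟨ thrice L ⟩
      + 3 * L ∎
      where
      open ≡-Reasoning
      thrice : ∀ L → L + L + L ≡ + 3 * L
      thrice = solve-∀

    both-before-freq : ∀ {x y z} → x ≢ y → x ≢ z → y ≢ z →
                       ∑[ i < N ] (χ (x ∷ z ∷ []) (word i) * χ (y ∷ z ∷ []) (word i)) ≡ L + L
    both-before-freq {x} {y} {z} x≢y x≢z y≢z =
      trans (sum-cong-≗ (λ i → both-before (word-unique i) (word-∋ i x) (word-∋ i y) (word-∋ i z) x≢y x≢z y≢z))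
            (trans (freq-+ (x ∷ y ∷ z ∷ []) (y ∷ x ∷ z ∷ []))
                   (cong₂ _+_ (triple-freq x≢y x≢z y≢z) (triple-freq (≢-sym x≢y) y≢z x≢z)))

    -- Every element of X orders 0 and 1 one way or the other, so |X| = 6λ.
    size : ∑[ i < N ] (+ 1) ≡ + 6 * L
    size = begin
      ∑[ i < N ] (+ 1)
        ≡⟨ sum-cong-≗ (λ i → order-dichotomy (word-unique i) (word-∋ i 1F) (word-∋ i 0F) (λ ())) ⟨
      ∑[ i < N ] (χ (1F ∷ 0F ∷ []) (word i) + χ (0F ∷ 1F ∷ []) (word i))
        ≡⟨ freq-+ (1F ∷ 0F ∷ []) (0F ∷ 1F ∷ []) ⟩
      freq (1F ∷ 0F ∷ []) + freq (0F ∷ 1F ∷ [])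
        ≡⟨ cong₂ _+_ (pair-freq 2F (λ ()) (λ ()) (λ ())) (pair-freq 2F (λ ()) (λ ()) (λ ())) ⟩
      + 3 * L + + 3 * L
        ≡⟨ twice L ⟩
      + 6 * L ∎
      where
      open ≡-Reasoning
      twice : ∀ L → + 3 * L + + 3 * L ≡ + 6 * L
      twice = solve-∀

    N≡6λ : N ≡ 6 ℕ.* λ′
    N≡6λ = +-injective (begin
      + N               ≡⟨ *-identityʳ (+ N) ⟨
      + N * + 1         ≡⟨ ∑-const N (+ 1) ⟨
      ∑[ i < N ] (+ 1)  ≡⟨ size ⟩
      + 6 * L           ≡⟨ pos-* 6 λ′ ⟨
      + (6 ℕ.* λ′)      ∎)
      where open ≡-Reasoning

    A C : ℤ
    A = + 4 * L
    C = + 2 * L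

    instance
      N-nonZero : NonZero N
      N-nonZero = subst NonZero (sym N≡6λ) (m*n≢0 6 λ′)

      A-positive : Positive A
      A-positive = *-positive (+ 4) L {{_}} {{positive-ℕ λ′}}

      C-nonNegative : NonNegative C
      C-nonNegative = *-nonNegative (+ 2) L

    -- sign b i = +1 if b + 1 precedes the pivot 0 in the i-th element, else -1.
    sign : Fin (2 ℕ.+ k) → Fin N → ℤ
    sign b i = + 2 * χ (suc b ∷ 0F ∷ []) (word i) - + 1

    sign-square : ∀ b i → sign b i * sign b i ≡ + 1
    sign-square b i with χ-01 (suc b ∷ 0F ∷ []) (word i)
    ... | inj₁ χ≡0 rewrite χ≡0 = refl
    ... | inj₂ χ≡1 rewrite χ≡1 = refl

    third : Fin (2 ℕ.+ k) → Fin (3 ℕ.+ k)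
    third zero    = 2F
    third (suc _) = 1F

    third≢0 : ∀ b → third b ≢ 0F
    third≢0 zero    ()
    third≢0 (suc b) ()

    third≢b : ∀ b → suc b ≢ third b
    third≢b zero    ()
    third≢b (suc b) ()

    centred : ∀ b → ∑[ i < N ] sign b i ≡ + 0
    centred b = begin
      ∑[ i < N ] sign b i
        ≡⟨ sum-cong-≗ (λ i → affine (χ (suc b ∷ 0F ∷ []) (word i))) ⟩
      ∑[ i < N ] (+ 2 * χ (suc b ∷ 0F ∷ []) (word i) + - + 1 * + 1)
        ≡⟨ ∑-linear₂ (+ 2) (- + 1) (λ i → χ (suc b ∷ 0F ∷ []) (word i)) (λ _ → + 1) ⟩
      + 2 * freq (suc b ∷ 0F ∷ []) + - + 1 * ∑[ i < N ] (+ 1)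
        ≡⟨ cong₂ (λ p q → + 2 * p + - + 1 * q) (pair-freq (third b) (λ ()) (third≢b b) (≢-sym (third≢0 b))) size ⟩
      + 2 * (+ 3 * L) + - + 1 * (+ 6 * L)
        ≡⟨ cancel L ⟩
      + 0 ∎
      where
      open ≡-Reasoning
      affine : ∀ p → + 2 * p - + 1 ≡ + 2 * p + - + 1 * + 1
      affine = solve-∀
      cancel : ∀ L → + 2 * (+ 3 * L) + - + 1 * (+ 6 * L) ≡ + 0
      cancel = solve-∀

    norm : ∀ b → ∑[ i < N ] (sign b i * sign b i) ≡ A + C
    norm b = trans (sum-cong-≗ (sign-square b)) (trans size (split L))
      where split : ∀ L → + 6 * L ≡ + 4 * L + + 2 * L
            split = solve-∀

    correlation : ∀ b b′ → b ≢ b′ → ∑[ i < N ] (sign b i * sign b′ i) ≡ C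
    correlation b b′ b≢b′ = begin
      ∑[ i < N ] (sign b i * sign b′ i)
        ≡⟨ sum-cong-≗ (λ i → expand (p i) (q i)) ⟩
      ∑[ i < N ] (+ 4 * (p i * q i) + - + 2 * (p i + q i) + + 1 * + 1)
        ≡⟨ ∑-linear₃ (+ 4) (- + 2) (+ 1) (λ i → p i * q i) (λ i → p i + q i) (λ _ → + 1) ⟩
      + 4 * ∑[ i < N ] (p i * q i) + - + 2 * ∑[ i < N ] (p i + q i) + + 1 * ∑[ i < N ] (+ 1)
        ≡⟨ cong₂ _+_ (cong₂ (λ r t → + 4 * r + - + 2 * t) (both-before-freq x≢y (λ ()) (λ ())) pair-sum)
                     (cong (+ 1 *_) size) ⟩
      + 4 * (L + L) + - + 2 * (+ 3 * L + + 3 * L) + + 1 * (+ 6 * L)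
        ≡⟨ collect L ⟩
      + 2 * L ∎
      where
      open ≡-Reasoning
      x y : Fin (3 ℕ.+ k)
      x = suc b
      y = suc b′
      x≢y : x ≢ y
      x≢y x≡y = b≢b′ (suc-injective x≡y)
      p q : Fin N → ℤ
      p i = χ (x ∷ 0F ∷ []) (word i)
      q i = χ (y ∷ 0F ∷ []) (word i)
      pair-sum : ∑[ i < N ] (p i + q i) ≡ + 3 * L + + 3 * L
      pair-sum = trans (freq-+ (x ∷ 0F ∷ []) (y ∷ 0F ∷ []))
                       (cong₂ _+_ (pair-freq (third b) (λ ()) (third≢b b) (≢-sym (third≢0 b)))
                                  (pair-freq (third b′) (λ ()) (third≢b b′) (≢-sym (third≢0 b′))))
      expand : ∀ p q → (+ 2 * p - + 1) * (+ 2 * q - + 1) ≡ + 4 * (p * q) + - + 2 * (p + q) + + 1 * + 1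
      expand = solve-∀
      collect : ∀ L → + 4 * (L + L) + - + 2 * (+ 3 * L + + 3 * L) + + 1 * (+ 6 * L) ≡ + 2 * L
      collect = solve-∀

open import Data.Nat using (_≤_; _*_; _≥_; s≤s; >-nonZero)

lemma2 : (n : ℕ) → n ≥ 3 → (λ′ : ℕ) → 1 ≤ λ′ → (X : List (Perm n)) →
         IsPSCA n 3 λ′ X → n ≤ 6 * λ′
lemma2 (suc (suc (suc k))) (s≤s (s≤s (s≤s _))) λ′ λ′≥1 X psca =
  subst (suc (suc (suc k)) ≤_) N≡6λ
        (GramRank.rank-bound N (suc (suc k)) A C sign centred norm correlation)
  where open PSCASigns.PivotSigns k λ′ {{>-nonZero λ′≥1}} X psca
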